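{- Let $T$ be a tree with diameter $d \ge 3$ and diametrical path $P: v_0, v_1, \ldots, v_d$. If there exists $i \in \{1, \ldots, d-2\}$ such that $v_i$ is adjacent to a leaf other than $v_0$ (when $i=1$) and $v_{i+1}$ is adjacent to a leaf other than $v_d$ (when $i+1=d-1$), then $\Gamma_b(T) > \operatorname{diam}(T)$.
   Context: All graphs are finite, simple, connected and nontrivial. A diametrical path of a tree $T$ of diameter $d$ is a path $v_0,\ldots,v_d$ of length $d$. For a graph $G=(V,E)$, a broadcast is a function $f: V \to \{0,1,\ldots,\operatorname{diam}(G)\}$ with $f(v) \le e(v)$ (the eccentricity of $v$) for all $v$. It is dominating if every $u \in V$ is at distance at most $f(v)$ from some $v$ with $f(v) \ge 1$. It is minimal dominating if it is dominating and no broadcast $f' \ne f$ with $f'(v)\le f(v)$ for all $v$ is dominating. The cost of $f$ is $\sigma(f)=\sum_{v} f(v)$, and $\Gamma_b(G)=\max\{\sigma(f): f \text{ minimal dominating broadcast on } G\}$. -}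

module Defs where

open import Data.Nat using (ℕ; zero; suc; _+_; _≤_; _<_; _∸_)
open import Data.Fin using (Fin)
open import Data.List using (List; map; allFin)
open import Data.Nat.ListAction using (sum)
open import Data.Product using (Σ; ∃; _×_; _,_)
open import Relation.Nullary using (¬_)
open import Relation.Binary.PropositionalEquality using (_≡_; _≢_)

record Graph (n : ℕ) : Set₁ where
  field
    Adj   : Fin n → Fin n → Set
    sym   : ∀ {u v} → Adj u v → Adj v u
    irrefl : ∀ {u} → ¬ Adj u u

module _ {n : ℕ} (G : Graph n) where
  open Graph G

  data Walk : Fin n → Fin n → ℕ → Set where
    nil  : ∀ {u} → Walk u u 0
    cons : ∀ {u w v k} → Adj u w → Walk w v k → Walk u v (suc k)

  DistLE : Fin n → Fin n → ℕ → Set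
  DistLE u v k = Σ ℕ λ k' → k' ≤ k × Walk u v k'

  Dist : Fin n → Fin n → ℕ → Set
  Dist u v k = Walk u v k × (∀ k' → Walk u v k' → k ≤ k')

  Connected : Set
  Connected = ∀ u v → Σ ℕ λ k → Walk u v k

  HasCycle : Set
  HasCycle = Σ ℕ λ k → Σ (ℕ → Fin n) λ w →
      3 ≤ k
    × (∀ i j → i < k → j < k → w i ≡ w j → i ≡ j)
    × (∀ i → suc i < k → Adj (w i) (w (suc i)))
    × Adj (w (k ∸ 1)) (w 0)

  IsTree : Set
  IsTree = 2 ≤ n × Connected × ¬ HasCycle

  Diameter : ℕ → Set
  Diameter d = (∀ u v → DistLE u v d) × (Σ (Fin n) λ u → Σ (Fin n) λ v → Dist u v d)

  -- a path v 0, …, v d of length d (the values v i for i > d are irrelevant)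
  IsPathOfLength : ℕ → (ℕ → Fin n) → Set
  IsPathOfLength d v =
      (∀ i j → i ≤ d → j ≤ d → v i ≡ v j → i ≡ j)
    × (∀ i → i < d → Adj (v i) (v (suc i)))

  DiametricalPath : ℕ → (ℕ → Fin n) → Set
  DiametricalPath d v = Diameter d × IsPathOfLength d v

  IsLeaf : Fin n → Set
  IsLeaf ℓ = Σ (Fin n) λ w → Adj ℓ w × (∀ w' → Adj ℓ w' → w' ≡ w)

  -- f(v) ≤ e(v): some vertex u has d(v,u) ≥ f(v)
  Broadcast : (Fin n → ℕ) → Set
  Broadcast f = ∀ v → Σ (Fin n) λ u → ∀ k → Walk v u k → f v ≤ k

  Dominating : (Fin n → ℕ) → Set
  Dominating f = ∀ u → Σ (Fin n) λ v → 1 ≤ f v × DistLE v u (f v)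

  MinimalDominating : (Fin n → ℕ) → Set
  MinimalDominating f =
      Broadcast f
    × Dominating f
    × (∀ f' → Broadcast f' → (∀ v → f' v ≤ f v) → Dominating f' → ∀ v → f' v ≡ f v)

  cost : (Fin n → ℕ) → ℕ
  cost f = sum (map f (allFin n))

  -- d < Γ_b(G): some minimal dominating broadcast has cost exceeding d
  -- (Γ_b is a maximum over a finite nonempty set, so this is what the inequality unfolds to)
  UpperBroadcastNumberExceeds : ℕ → Set
  UpperBroadcastNumberExceeds d = Σ (Fin n → ℕ) λ f → MinimalDominating f × d < cost f

module Submission where

-- Let F be the broadcast with F (v 0) = i+1, F (v d) = d−i, F = 0 on the four
-- "silent" vertices ℓ₁, v i, ℓ₂, v (i+1), and F = 1 everywhere else.  F is a
-- dominating broadcast: v 0 reaches v i and ℓ₁, v d reaches v (i+1) and ℓ₂.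
-- Any dominating g ≤ F must still dominate ℓ₁ and ℓ₂; only v 0 and v d have
-- enough range for that, and distances in the tree then force g (v 0) ≥ i+1
-- and g (v d) ≥ d−i.  Lowering F one unit at a time while it stays
-- dominating ends in a minimal dominating broadcast h ≤ F, whose cost is thus
-- at least (i+1) + (d−i) = d+1.

open import Defs
open import Data.Nat using (ℕ; zero; suc; _+_; _∸_; _≤_; _<_; _≤?_; z≤n; s≤s; pred)
open import Data.Nat.Properties
open import Data.Nat.ListAction using (sum)
open import Data.Fin using (Fin) renaming (_≟_ to _≟ᶠ_)
open import Data.Fin.Properties using (all?; any?)
open import Data.List using ([]; _∷_; map; allFin)
open import Data.List.Relation.Unary.Any using (here; there)
open import Data.List.Membership.Propositional using (_∈_)
open import Data.List.Membership.Propositional.Properties using (∈-allFin)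
open import Data.Product using (Σ; _×_; _,_; proj₁; proj₂)
open import Data.Sum using (_⊎_; inj₁; inj₂)
open import Data.Empty using (⊥-elim)
open import Relation.Nullary using (¬_; Dec; yes; no)
open import Relation.Nullary.Decidable using (_×-dec_; _⊎-dec_)
open import Relation.Binary.PropositionalEquality
  using (_≡_; _≢_; refl; sym; trans; cong; subst; subst₂)

∸-peel : ∀ m t → t < m → m ∸ t ≡ suc (m ∸ suc t)
∸-peel (suc m) zero    _         = refl
∸-peel (suc m) (suc t) (s≤s t<m) = ∸-peel m t t<m

_≼_ : {A : Set} → (A → ℕ) → (A → ℕ) → Set
g ≼ h = ∀ x → g x ≤ h x

module _ {A : Set} where

  sum-map-mono : {g h : A → ℕ} → g ≼ h → ∀ xs → sum (map g xs) ≤ sum (map h xs)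
  sum-map-mono g≼h []       = z≤n
  sum-map-mono g≼h (x ∷ xs) = +-mono-≤ (g≼h x) (sum-map-mono g≼h xs)

  sum-map-mono-< : {g h : A → ℕ} → g ≼ h → ∀ {y xs} → y ∈ xs → g y < h y →
    sum (map g xs) < sum (map h xs)
  sum-map-mono-< g≼h {xs = x ∷ xs} (here refl) gy<hy = +-mono-<-≤ gy<hy (sum-map-mono g≼h xs)
  sum-map-mono-< g≼h {xs = x ∷ xs} (there y∈) gy<hy = +-mono-≤-< (g≼h x) (sum-map-mono-< g≼h y∈ gy<hy)

  term≤sum : (g : A → ℕ) → ∀ {y xs} → y ∈ xs → g y ≤ sum (map g xs)
  term≤sum g {xs = x ∷ xs} (here refl) = m≤m+n (g x) _
  term≤sum g {xs = x ∷ xs} (there y∈)  = ≤-trans (term≤sum g y∈) (m≤n+m _ (g x))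

  twoTerms≤sum : (g : A → ℕ) → ∀ {a b xs} → a ≢ b → a ∈ xs → b ∈ xs →
    g a + g b ≤ sum (map g xs)
  twoTerms≤sum g a≢b (here refl) (here refl) = ⊥-elim (a≢b refl)
  twoTerms≤sum g {a} _ (here refl) (there b∈) = +-monoʳ-≤ (g a) (term≤sum g b∈)
  twoTerms≤sum g {a} {b} _ (there a∈) (here refl) =
    ≤-trans (≤-reflexive (+-comm (g a) (g b))) (+-monoʳ-≤ (g b) (term≤sum g a∈))
  twoTerms≤sum g {xs = x ∷ xs} a≢b (there a∈) (there b∈) =
    ≤-trans (twoTerms≤sum g a≢b a∈ b∈) (m≤n+m _ (g x))

_◃_ : {n : ℕ} → Fin n → (ℕ → Fin n) → ℕ → Fin n
(ℓ ◃ p) zero    = ℓ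
(ℓ ◃ p) (suc t) = p t

module Paths {n : ℕ} (G : Graph n) where
  open Graph G renaming (sym to adj-sym)

  snoc : ∀ {x y z k} → Walk G x y k → Adj y z → Walk G x z (suc k)
  snoc nil        y~z = cons y~z nil
  snoc (cons a w) y~z = cons a (snoc w y~z)

  reverse : ∀ {x y k} → Walk G x y k → Walk G y x k
  reverse nil        = nil
  reverse (cons a w) = snoc (reverse w) (adj-sym a)

  walkAlong : (p : ℕ → Fin n) (m : ℕ) → (∀ t → t < m → Adj (p t) (p (suc t))) →
    Walk G (p 0) (p m) m
  walkAlong p zero    _    = nil
  walkAlong p (suc m) step =
    cons (step 0 (s≤s z≤n)) (walkAlong (λ t → p (suc t)) m (λ t t<m → step (suc t) (s≤s t<m)))

  walk≢⇒1≤ : ∀ {x y k} → x ≢ y → Walk G x y k → 1 ≤ k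
  walk≢⇒1≤ x≢x nil        = ⊥-elim (x≢x refl)
  walk≢⇒1≤ _   (cons _ _) = s≤s z≤n

  leaf-neighbour : ∀ {ℓ a b} → IsLeaf G ℓ → Adj ℓ a → Adj ℓ b → a ≡ b
  leaf-neighbour (_ , _ , unique) ℓ~a ℓ~b = trans (unique _ ℓ~a) (sym (unique _ ℓ~b))

  nearLeaf : ∀ {ℓ u y k} → IsLeaf G ℓ → Adj u ℓ → Walk G y ℓ k → k ≤ 1 → y ≡ ℓ ⊎ y ≡ u
  nearLeaf _    _   nil                 _         = inj₁ refl
  nearLeaf leaf u~ℓ (cons y~ℓ nil)      _         =
    inj₂ (leaf-neighbour leaf (adj-sym y~ℓ) (adj-sym u~ℓ))
  nearLeaf _    _   (cons _ (cons _ _)) (s≤s ())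

  trivialPath : ∀ x → IsPathOfLength G 0 (λ _ → x)
  trivialPath x = (λ a b a≤0 b≤0 _ → trans (n≤0⇒n≡0 a≤0) (sym (n≤0⇒n≡0 b≤0))) , (λ _ ())

  takePath : ∀ {m j p} → j ≤ m → IsPathOfLength G m p → IsPathOfLength G j p
  takePath j≤m (distinct , step) =
    (λ a b a≤j b≤j → distinct a b (≤-trans a≤j j≤m) (≤-trans b≤j j≤m)) ,
    (λ t t<j → step t (≤-trans t<j j≤m))

  dropPath : ∀ {m j p} → j ≤ m → IsPathOfLength G m p → IsPathOfLength G (m ∸ j) (λ t → p (j + t))
  dropPath {m} {j} {p} j≤m (distinct , step) =
    (λ a b a≤ b≤ pa≡pb → +-cancelˡ-≡ j a b (distinct (j + a) (j + b) (shift a≤) (shift b≤) pa≡pb)) ,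
    (λ t t< → subst (λ s → Adj (p (j + t)) (p s)) (sym (+-suc j t))
                (step (j + t) (subst (_≤ m) (+-suc j t) (shift t<))))
    where
    shift : ∀ {t} → t ≤ m ∸ j → j + t ≤ m
    shift t≤ = ≤-trans (+-monoʳ-≤ j t≤) (≤-reflexive (m+[n∸m]≡n j≤m))

  reversePath : ∀ {m p} → IsPathOfLength G m p → IsPathOfLength G m (λ t → p (m ∸ t))
  reversePath {m} {p} (distinct , step) =
    (λ a b a≤m b≤m pa≡pb → ∸-cancelˡ-≡ a≤m b≤m (distinct (m ∸ a) (m ∸ b) (m∸n≤m m a) (m∸n≤m m b) pa≡pb)) ,
    stepBack
    where
    stepBack : ∀ t → t < m → Adj (p (m ∸ t)) (p (m ∸ suc t))
    stepBack t t<m rewrite ∸-peel m t t<m =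
      adj-sym (step (m ∸ suc t) (≤-trans (≤-reflexive (sym (∸-peel m t t<m))) (m∸n≤m m t)))

  consPath : ∀ {m p ℓ} → IsPathOfLength G m p → (∀ t → t ≤ m → ℓ ≢ p t) → Adj ℓ (p 0) →
    IsPathOfLength G (suc m) (ℓ ◃ p)
  consPath {m} {p} {ℓ} (distinct , step) fresh ℓ~p0 = distinct′ , step′
    where
    distinct′ : ∀ a b → a ≤ suc m → b ≤ suc m → (ℓ ◃ p) a ≡ (ℓ ◃ p) b → a ≡ b
    distinct′ zero    zero    _   _   _  = refl
    distinct′ zero    (suc b) _   b≤m eq = ⊥-elim (fresh b (≤-pred b≤m) eq)
    distinct′ (suc a) zero    a≤m _   eq = ⊥-elim (fresh a (≤-pred a≤m) (sym eq))
    distinct′ (suc a) (suc b) a≤m b≤m eq = cong suc (distinct a b (≤-pred a≤m) (≤-pred b≤m) eq)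
    step′ : ∀ t → t < suc m → Adj ((ℓ ◃ p) t) ((ℓ ◃ p) (suc t))
    step′ zero    _   = ℓ~p0
    step′ (suc t) t<m = step t (≤-pred t<m)

  closePath : ∀ {j p} → 2 ≤ j → IsPathOfLength G j p → Adj (p j) (p 0) → HasCycle G
  closePath {j} {p} 2≤j (distinct , step) back =
    suc j , p , s≤s 2≤j ,
    (λ a b a≤j b≤j → distinct a b (≤-pred a≤j) (≤-pred b≤j)) ,
    (λ t t<j → step t (≤-pred t<j)) ,
    back

  -- By
  -- induction on the walk x ~ w ⋯ y: if w lies on the path p it must be p 1
  -- (p 0 = x is not adjacent to itself and a later p j would close a cycle),
  -- otherwise w can be prepended to p.
  pathIsShortest : ¬ HasCycle G → ∀ {x y k m p} → Walk G x y k → IsPathOfLength G m p →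
    p 0 ≡ x → p m ≡ y → m ≤ k
  pathIsShortest _ nil (distinct , _) p0≡x pm≡x with distinct 0 _ z≤n ≤-refl (trans p0≡x (sym pm≡x))
  ... | refl = z≤n
  pathIsShortest _ {m = zero} (cons _ _) _ _ _ = z≤n
  pathIsShortest acyclic {x} {m = suc m} {p} (cons {w = w} x~w rest) path p0≡x pm≡y
    with anyUpTo? (λ j → p j ≟ᶠ w) (suc (suc m))
  ... | yes (zero , _ , p0≡w) = ⊥-elim (irrefl (subst (Adj x) (trans (sym p0≡w) p0≡x) x~w))
  ... | yes (suc zero , _ , p1≡w) =
    s≤s (pathIsShortest acyclic rest (dropPath (s≤s z≤n) path) p1≡w pm≡y)
  ... | yes (suc (suc j) , j<m , pj≡w) =
    ⊥-elim (acyclic (closePath (s≤s (s≤s z≤n)) (takePath (≤-pred j<m) path)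
                      (subst₂ Adj (sym pj≡w) (sym p0≡x) (adj-sym x~w))))
  ... | no w∉p =
    <⇒≤ (m≤n⇒m≤1+n (pathIsShortest acyclic rest
      (consPath path (λ t t≤m w≡pt → w∉p (t , s≤s t≤m , sym w≡pt)) (subst (Adj w) (sym p0≡x) (adj-sym x~w)))
      refl pm≡y))

  beyondPath : ¬ HasCycle G → ∀ {m s x y ℓ k} → IsPathOfLength G m s → (∀ t → t ≤ m → ℓ ≢ s t) →
    s 0 ≡ x → Adj x ℓ → s m ≡ y → Walk G y ℓ k → suc m ≤ k
  beyondPath acyclic {ℓ = ℓ} path fresh s0≡x x~ℓ sm≡y w =
    pathIsShortest acyclic (reverse w) (consPath path fresh (subst (Adj ℓ) (sym s0≡x) (adj-sym x~ℓ))) refl sm≡y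

  -- Every walk shortens to a path between the same ends: if the start x
  -- reappears on the path obtained from the rest of the walk, cut there.
  walkToPath : ∀ {x y k} → Walk G x y k →
    Σ ℕ λ m → Σ (ℕ → Fin n) λ p → IsPathOfLength G m p × p 0 ≡ x × p m ≡ y
  walkToPath {x} nil = 0 , (λ _ → x) , trivialPath x , refl , refl
  walkToPath {x} (cons x~w rest) with walkToPath rest
  ... | m , q , path , q0≡w , qm≡y with anyUpTo? (λ j → q j ≟ᶠ x) (suc m)
  ...   | yes (j , j≤m , qj≡x) =
    m ∸ j , (λ t → q (j + t)) , dropPath (≤-pred j≤m) path ,
    trans (cong q (+-identityʳ j)) qj≡x , trans (cong q (m+[n∸m]≡n (≤-pred j≤m))) qm≡y
  ...   | no x∉q =
    suc m , x ◃ q ,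
    consPath path (λ t t≤m x≡qt → x∉q (t , s≤s t≤m , sym x≡qt)) (subst (Adj x) (sym q0≡w) x~w) ,
    refl , qm≡y

  -- In a tree, d(x,y) ≤ k is decidable: compare k with the length of a path.
  distLE? : ¬ HasCycle G → Connected G → ∀ x y k → Dec (DistLE G x y k)
  distLE? acyclic connected x y k with walkToPath (proj₂ (connected x y))
  ... | m , p , path , p0≡x , pm≡y with m ≤? k
  ...   | yes m≤k = yes (m , m≤k , subst₂ (λ a b → Walk G a b m) p0≡x pm≡y (walkAlong p m (proj₂ path)))
  ...   | no  m≰k = no λ { (k′ , k′≤k , w) → m≰k (≤-trans (pathIsShortest acyclic w path p0≡x pm≡y) k′≤k) }

  dominating? : ¬ HasCycle G → Connected G → ∀ f → Dec (Dominating G f)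
  dominating? acyclic connected f =
    all? λ u → any? λ v → (1 ≤? f v) ×-dec distLE? acyclic connected v u (f v)

lower : {n : ℕ} → (Fin n → ℕ) → Fin n → Fin n → ℕ
lower g v x with x ≟ᶠ v
... | yes _ = pred (g v)
... | no  _ = g x

lower-≼ : {n : ℕ} (g : Fin n → ℕ) (v : Fin n) → lower g v ≼ g
lower-≼ g v x with x ≟ᶠ v
... | yes refl = pred[n]≤n
... | no  _    = ≤-refl

lower-< : {n : ℕ} (g : Fin n → ℕ) (v : Fin n) → 1 ≤ g v → lower g v v < g v
lower-< g v 1≤gv with v ≟ᶠ v
... | yes _   = pred< 1≤gv
  where
  pred< : ∀ {a} → 1 ≤ a → pred a < a
  pred< {suc a} _ = ≤-refl
... | no  v≢v = ⊥-elim (v≢v refl)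

≼-lower : {n : ℕ} {f g : Fin n → ℕ} (v : Fin n) → f ≼ g → f v < g v → f ≼ lower g v
≼-lower v f≼g fv<gv x with x ≟ᶠ v
... | yes refl = suc[m]≤n⇒m≤pred[n] fv<gv
... | no  _    = f≼g x

module Minimisation {n : ℕ} (G : Graph n) where

  dominating-mono : ∀ {g h} → g ≼ h → Dominating G g → Dominating G h
  dominating-mono g≼h dom u with dom u
  ... | w , 1≤gw , (k , k≤gw , walk) = w , ≤-trans 1≤gw (g≼h w) , (k , ≤-trans k≤gw (g≼h w) , walk)

  broadcast-antimono : ∀ {g h} → g ≼ h → Broadcast G h → Broadcast G g
  broadcast-antimono g≼h bc x with bc x
  ... | u , far = u , λ k walk → ≤-trans (g≼h x) (far k walk)

  Minimal : (Fin n → ℕ) → Set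
  Minimal g = ∀ f′ → Broadcast G f′ → f′ ≼ g → Dominating G f′ → ∀ v → f′ v ≡ g v

  module _ (dominating? : ∀ f → Dec (Dominating G f)) where

    -- Lower some positive value while domination survives.  Each step
    -- decreases the cost, which b bounds.  When no single step is possible,
    -- g is minimal: a dominating f′ ≤ g with f′ x < g x lies below lower g x.
    descend : ∀ b g → cost G g < b → Dominating G g →
      Σ (Fin n → ℕ) λ h → h ≼ g × Dominating G h × Minimal h
    descend zero g () _
    descend (suc b) g cost<b dom with any? (λ v → (1 ≤? g v) ×-dec dominating? (lower g v))
    ... | yes (v , 1≤gv , dom′)
      with descend b (lower g v)
             (≤-trans (sum-map-mono-< (lower-≼ g v) (∈-allFin v) (lower-< g v 1≤gv)) (≤-pred cost<b)) dom′
    ...   | h , h≼ , h-dom , h-min = h , (λ x → ≤-trans (h≼ x) (lower-≼ g v x)) , h-dom , h-min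
    descend (suc b) g cost<b dom | no stuck = g , (λ _ → ≤-refl) , dom , minimal
      where
      minimal : Minimal g
      minimal f′ _ f′≼g f′-dom x with f′ x ≟ g x
      ... | yes eq  = eq
      ... | no  f′x≢gx =
        ⊥-elim (stuck (x , ≤-trans (s≤s z≤n) f′x<gx , dominating-mono (≼-lower x f′≼g f′x<gx) f′-dom))
        where
        f′x<gx : f′ x < g x
        f′x<gx = ≤∧≢⇒< (f′≼g x) f′x≢gx

    minimalDominatingBelow : ∀ g → Broadcast G g → Dominating G g →
      Σ (Fin n → ℕ) λ h → h ≼ g × MinimalDominating G h
    minimalDominatingBelow g bc dom with descend (suc (cost G g)) g ≤-refl dom
    ... | h , h≼g , h-dom , h-min = h , h≼g , broadcast-antimono h≼g bc , h-dom , h-min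

module AlongPath {n : ℕ} (T : Graph n) (acyclic : ¬ HasCycle T)
                 (d : ℕ) (v : ℕ → Fin n) (path : IsPathOfLength T d v) where
  open Graph T renaming (sym to adj-sym)
  open Paths T

  distinct : ∀ a b → a ≤ d → b ≤ d → v a ≡ v b → a ≡ b
  distinct = proj₁ path

  step : ∀ t → t < d → Adj (v t) (v (suc t))
  step = proj₂ path

  walkFromStart : ∀ j → j ≤ d → Walk T (v 0) (v j) j
  walkFromStart j j≤d = walkAlong v j (λ t t<j → step t (≤-trans t<j j≤d))

  walkFromEnd : ∀ j → j ≤ d → Walk T (v d) (v j) (d ∸ j)
  walkFromEnd j j≤d =
    subst (λ s → Walk T (v d) (v s) (d ∸ j)) (m∸[m∸n]≡n j≤d)
      (walkAlong (λ t → v (d ∸ t)) (d ∸ j) (λ t t< → proj₂ (reversePath path) t (≤-trans t< (m∸n≤m d j))))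

  endsFar : ∀ {k} → Walk T (v 0) (v d) k → d ≤ k
  endsFar w = pathIsShortest acyclic w path refl refl

  -- A leaf hanging from v j (j < d) is not on the path, unless it is the
  -- end v 0 with j = 1 or the end v d with j = d − 1: inner path vertices
  -- have two neighbours, and each end has the neighbour v 1 resp. v (d−1).
  leafOffPath : ∀ {ℓ j} → IsLeaf T ℓ → Adj (v j) ℓ → j < d → (j ≡ 1 → ℓ ≢ v 0) →
    (j ≡ d ∸ 1 → ℓ ≢ v d) → ∀ t → t ≤ d → ℓ ≢ v t
  leafOffPath {j = j} leaf vj~ℓ j<d notStart _ zero _ refl =
    notStart (distinct j 1 (<⇒≤ j<d) 1≤d
               (leaf-neighbour leaf (adj-sym vj~ℓ) (step 0 1≤d))) refl
    where
    1≤d : 1 ≤ d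
    1≤d = ≤-trans (s≤s z≤n) j<d
  leafOffPath {j = j} leaf vj~ℓ j<d _ notEnd (suc t) t<d refl with suc t ≟ d
  ... | yes refl =
    notEnd (distinct j t (<⇒≤ j<d) (n≤1+n t)
             (leaf-neighbour leaf (adj-sym vj~ℓ) (adj-sym (step t ≤-refl)))) refl
  ... | no t+1≢d =
    n≮n (suc (suc t)) (subst (_< suc (suc t)) (distinct t (suc (suc t)) (<⇒≤ t<d) t+2≤d
                         (leaf-neighbour leaf (adj-sym (step t t<d)) (step (suc t) t+2≤d))) (n≤1+n (suc t)))
    where
    t+2≤d : suc (suc t) ≤ d
    t+2≤d = ≤∧≢⇒< t<d t+1≢d

  hangingFromStart : ∀ {j ℓ k} → j ≤ d → (∀ t → t ≤ d → ℓ ≢ v t) → Adj (v j) ℓ →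
    Walk T (v 0) ℓ k → suc j ≤ k
  hangingFromStart {j} j≤d off vj~ℓ =
    beyondPath acyclic (reversePath (takePath j≤d path))
      (λ t _ → off (j ∸ t) (≤-trans (m∸n≤m j t) j≤d)) refl vj~ℓ (cong v (n∸n≡0 j))

  hangingFromEnd : ∀ {j ℓ k} → j ≤ d → (∀ t → t ≤ d → ℓ ≢ v t) → Adj (v j) ℓ →
    Walk T (v d) ℓ k → suc (d ∸ j) ≤ k
  hangingFromEnd {j} j≤d off vj~ℓ =
    beyondPath acyclic (dropPath j≤d path)
      (λ t t≤ → off (j + t) (≤-trans (+-monoʳ-≤ j t≤) (≤-reflexive (m+[n∸m]≡n j≤d))))
      (cong v (+-identityʳ j)) vj~ℓ (cong v (m+[n∸m]≡n j≤d))

module Construction {n : ℕ} (T : Graph n) (acyclic : ¬ HasCycle T) (connected : Connected T)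
  (d : ℕ) (3≤d : 3 ≤ d) (v : ℕ → Fin n) (path : IsPathOfLength T d v)
  (i : ℕ) (1≤i : 1 ≤ i) (i≤d∸2 : i ≤ d ∸ 2)
  (ℓ₁ : Fin n) (leaf₁ : IsLeaf T ℓ₁) (vi~ℓ₁ : Graph.Adj T (v i) ℓ₁) (ℓ₁≢start : i ≡ 1 → ℓ₁ ≢ v 0)
  (ℓ₂ : Fin n) (leaf₂ : IsLeaf T ℓ₂) (vi+1~ℓ₂ : Graph.Adj T (v (suc i)) ℓ₂)
  (ℓ₂≢end : suc i ≡ d ∸ 1 → ℓ₂ ≢ v d) where

  open Paths T
  open Minimisation T
  open AlongPath T acyclic d v path

  i+2≤d : suc (suc i) ≤ d
  i+2≤d = subst (_≤ d) (+-comm i 2) (m≤o∸n⇒m+n≤o i (≤-trans (s≤s (s≤s z≤n)) 3≤d) i≤d∸2)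

  i+1≤d : suc i ≤ d
  i+1≤d = <⇒≤ i+2≤d

  i≤d : i ≤ d
  i≤d = ≤-trans (n≤1+n i) i+1≤d

  d∸i≡ : d ∸ i ≡ suc (d ∸ suc i)
  d∸i≡ = ∸-peel d i i+1≤d

  start≢end : v 0 ≢ v d
  start≢end v0≡vd = n≮n 0 (subst (0 <_) (sym (distinct 0 d z≤n ≤-refl v0≡vd)) (≤-trans (s≤s z≤n) 3≤d))

  ℓ₁-off : ∀ t → t ≤ d → ℓ₁ ≢ v t
  ℓ₁-off = leafOffPath leaf₁ vi~ℓ₁ i+1≤d ℓ₁≢start
             (λ i≡d∸1 → ⊥-elim (n≮n i (subst (i <_) (sym i≡d∸1) (∸-monoˡ-≤ 1 i+2≤d))))

  ℓ₂-off : ∀ t → t ≤ d → ℓ₂ ≢ v t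
  ℓ₂-off = leafOffPath leaf₂ vi+1~ℓ₂ i+2≤d
             (λ i+1≡1 → ⊥-elim (n≮n 0 (subst (0 <_) (suc-injective i+1≡1) 1≤i))) ℓ₂≢end

  Silent : Fin n → Set
  Silent x = (x ≡ ℓ₁ ⊎ x ≡ v i) ⊎ (x ≡ ℓ₂ ⊎ x ≡ v (suc i))

  silent? : ∀ x → Dec (Silent x)
  silent? x = ((x ≟ᶠ ℓ₁) ⊎-dec (x ≟ᶠ v i)) ⊎-dec ((x ≟ᶠ ℓ₂) ⊎-dec (x ≟ᶠ v (suc i)))

  F : Fin n → ℕ
  F x with x ≟ᶠ v 0
  ... | yes _ = suc i
  ... | no  _ with x ≟ᶠ v d
  ...   | yes _ = d ∸ i
  ...   | no  _ with silent? x
  ...     | yes _ = 0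
  ...     | no  _ = 1

  data FCase (x : Fin n) (r : ℕ) : Set where
    atStart : x ≡ v 0 → r ≡ suc i → FCase x r
    atEnd   : x ≢ v 0 → x ≡ v d → r ≡ d ∸ i → FCase x r
    silent  : x ≢ v 0 → x ≢ v d → Silent x → r ≡ 0 → FCase x r
    other   : x ≢ v 0 → x ≢ v d → ¬ Silent x → r ≡ 1 → FCase x r

  fCase : ∀ x → FCase x (F x)
  fCase x with x ≟ᶠ v 0
  ... | yes x≡v0 = atStart x≡v0 refl
  ... | no  x≢v0 with x ≟ᶠ v d
  ...   | yes x≡vd = atEnd x≢v0 x≡vd refl
  ...   | no  x≢vd with silent? x
  ...     | yes s = silent x≢v0 x≢vd s refl
  ...     | no  s = other x≢v0 x≢vd s refl

  F-start : F (v 0) ≡ suc i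
  F-start with fCase (v 0)
  ... | atStart _ r       = r
  ... | atEnd v0≢v0 _ _   = ⊥-elim (v0≢v0 refl)
  ... | silent v0≢v0 _ _ _ = ⊥-elim (v0≢v0 refl)
  ... | other v0≢v0 _ _ _  = ⊥-elim (v0≢v0 refl)

  F-end : F (v d) ≡ d ∸ i
  F-end with fCase (v d)
  ... | atStart vd≡v0 _    = ⊥-elim (start≢end (sym vd≡v0))
  ... | atEnd _ _ r        = r
  ... | silent _ vd≢vd _ _ = ⊥-elim (vd≢vd refl)
  ... | other _ vd≢vd _ _  = ⊥-elim (vd≢vd refl)

  -- Each vertex u is dominated by F: by itself if F u ≥ 1, otherwise along the path.
  Covers : Fin n → Fin n → Set
  Covers w u = 1 ≤ F w × DistLE T w u (F w)

  coveredFromStart : ∀ {u k} → k ≤ suc i → Walk T (v 0) u k → Σ (Fin n) λ w → Covers w u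
  coveredFromStart k≤ walk =
    v 0 , subst (1 ≤_) (sym F-start) (s≤s z≤n) , (_ , subst (_ ≤_) (sym F-start) k≤ , walk)

  coveredFromEnd : ∀ {u k} → k ≤ d ∸ i → Walk T (v d) u k → Σ (Fin n) λ w → Covers w u
  coveredFromEnd k≤ walk =
    v d , subst (1 ≤_) (sym (trans F-end d∸i≡)) (s≤s z≤n) , (_ , subst (_ ≤_) (sym F-end) k≤ , walk)

  F-dominating : Dominating T F
  F-dominating u with fCase u
  ... | atStart _ r   = u , subst (1 ≤_) (sym r) (s≤s z≤n) , (0 , z≤n , nil)
  ... | atEnd _ _ r   = u , subst (1 ≤_) (sym (trans r d∸i≡)) (s≤s z≤n) , (0 , z≤n , nil)
  ... | other _ _ _ r = u , subst (1 ≤_) (sym r) ≤-refl , (0 , z≤n , nil)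
  ... | silent _ _ (inj₁ (inj₁ refl)) _ = coveredFromStart ≤-refl (snoc (walkFromStart i i≤d) vi~ℓ₁)
  ... | silent _ _ (inj₁ (inj₂ refl)) _ = coveredFromStart (n≤1+n i) (walkFromStart i i≤d)
  ... | silent _ _ (inj₂ (inj₁ refl)) _ =
    coveredFromEnd (≤-reflexive (sym d∸i≡)) (snoc (walkFromEnd (suc i) i+1≤d) vi+1~ℓ₂)
  ... | silent _ _ (inj₂ (inj₂ refl)) _ =
    coveredFromEnd (≤-trans (n≤1+n _) (≤-reflexive (sym d∸i≡))) (walkFromEnd (suc i) i+1≤d)

  -- F respects eccentricities: v 0 and v d are d apart, and every vertex other
  -- than v 0 has eccentricity at least 1.
  F-broadcast : Broadcast T F
  F-broadcast x with fCase x
  ... | atStart refl r = v d , λ k walk → subst (_≤ k) (sym r) (≤-trans i+1≤d (endsFar walk))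
  ... | atEnd _ refl r = v 0 , λ k walk → subst (_≤ k) (sym r) (≤-trans (m∸n≤m d i) (endsFar (reverse walk)))
  ... | silent _ _ _ r = x , λ k _ → subst (_≤ k) (sym r) z≤n
  ... | other x≢v0 _ _ r = v 0 , λ k walk → subst (_≤ k) (sym r) (walk≢⇒1≤ x≢v0 walk)

  -- Under a broadcast g ≤ F, a silent leaf hanging from a silent vertex can
  -- only be dominated from v 0 or v d: every other vertex has range ≤ 1, and
  -- the vertices within distance 1 of the leaf are silent.
  leafDominatedFromEnds : ∀ {g ℓ u y k} → g ≼ F → IsLeaf T ℓ → Graph.Adj T u ℓ → Silent ℓ → Silent u →
    1 ≤ g y → k ≤ g y → Walk T y ℓ k → y ≡ v 0 ⊎ y ≡ v d
  leafDominatedFromEnds {g} {y = y} g≼F leaf u~ℓ silentℓ silentu 1≤gy k≤gy walk with fCase y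
  ... | atStart y≡v0 _ = inj₁ y≡v0
  ... | atEnd _ y≡vd _ = inj₂ y≡vd
  ... | silent _ _ _ r = ⊥-elim (n≮0 (≤-trans 1≤gy (subst (g y ≤_) r (g≼F y))))
  ... | other _ _ notSilent r with nearLeaf leaf u~ℓ walk (≤-trans k≤gy (subst (g y ≤_) r (g≼F y)))
  ...   | inj₁ refl = ⊥-elim (notSilent silentℓ)
  ...   | inj₂ refl = ⊥-elim (notSilent silentu)

  start-budget : ∀ {g} → g ≼ F → Dominating T g → suc i ≤ g (v 0)
  start-budget {g} g≼F dom with dom ℓ₁
  ... | y , 1≤gy , (k , k≤gy , walk)
    with leafDominatedFromEnds g≼F leaf₁ vi~ℓ₁ (inj₁ (inj₁ refl)) (inj₁ (inj₂ refl)) 1≤gy k≤gy walk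
  ...   | inj₁ refl = ≤-trans (hangingFromStart i≤d ℓ₁-off vi~ℓ₁ walk) k≤gy
  ...   | inj₂ refl = ⊥-elim (n≮n (d ∸ i)
            (≤-trans (hangingFromEnd i≤d ℓ₁-off vi~ℓ₁ walk)
              (≤-trans k≤gy (≤-trans (g≼F (v d)) (≤-reflexive F-end)))))

  end-budget : ∀ {g} → g ≼ F → Dominating T g → d ∸ i ≤ g (v d)
  end-budget {g} g≼F dom with dom ℓ₂
  ... | y , 1≤gy , (k , k≤gy , walk)
    with leafDominatedFromEnds g≼F leaf₂ vi+1~ℓ₂ (inj₂ (inj₁ refl)) (inj₂ (inj₂ refl)) 1≤gy k≤gy walk
  ...   | inj₁ refl = ⊥-elim (n≮n (suc i)
            (≤-trans (hangingFromStart i+1≤d ℓ₂-off vi+1~ℓ₂ walk)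
              (≤-trans k≤gy (≤-trans (g≼F (v 0)) (≤-reflexive F-start)))))
  ...   | inj₂ refl = ≤-trans (≤-reflexive d∸i≡) (≤-trans (hangingFromEnd i+1≤d ℓ₂-off vi+1~ℓ₂ walk) k≤gy)

  exceedsDiameter : UpperBroadcastNumberExceeds T d
  exceedsDiameter
    with minimalDominatingBelow (dominating? acyclic connected) F F-broadcast F-dominating
  ... | h , h≼F , h-minimal@(_ , h-dom , _) = h , h-minimal , (begin-strict
    d                  <⟨ s≤s (≤-reflexive (sym (m+[n∸m]≡n i≤d))) ⟩
    suc i + (d ∸ i)    ≤⟨ +-mono-≤ (start-budget h≼F h-dom) (end-budget h≼F h-dom) ⟩
    h (v 0) + h (v d)  ≤⟨ twoTerms≤sum h start≢end (∈-allFin (v 0)) (∈-allFin (v d)) ⟩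
    cost T h           ∎)
    where open ≤-Reasoning

lemma3p1 : (n : ℕ) (T : Graph n) → IsTree T →
    (d : ℕ) → 3 ≤ d → (v : ℕ → Fin n) → DiametricalPath T d v →
    (Σ ℕ λ i → 1 ≤ i × i ≤ d ∸ 2
    × (Σ (Fin n) λ ℓ → IsLeaf T ℓ × Graph.Adj T (v i) ℓ × (i ≡ 1 → ℓ ≢ v 0))
    × (Σ (Fin n) λ ℓ → IsLeaf T ℓ × Graph.Adj T (v (suc i)) ℓ × (suc i ≡ d ∸ 1 → ℓ ≢ v d))) →
    UpperBroadcastNumberExceeds T d
lemma3p1 n T (_ , connected , acyclic) d 3≤d v (_ , path)
         (i , 1≤i , i≤d∸2 , (ℓ₁ , leaf₁ , vi~ℓ₁ , ℓ₁≢v0) , (ℓ₂ , leaf₂ , vi+1~ℓ₂ , ℓ₂≢vd)) =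
  Construction.exceedsDiameter T acyclic connected d 3≤d v path
    i 1≤i i≤d∸2 ℓ₁ leaf₁ vi~ℓ₁ ℓ₁≢v0 ℓ₂ leaf₂ vi+1~ℓ₂ ℓ₂≢vd
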